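{- Let $p$ be a prime and fix a positive integer $k$. Let $c_1 = 0$, and for $i \geq 2$ let $c_i := p^{p^{k}c_{i-1}} + c_{i-1}$. For a positive integer $n$, let \[ C_n := \{c \in \mathbb{Z}_{>0} : \nu_p(c_{n+1}-c) = p^{k}c\}. \] Then $C_n = \{c_2, \ldots, c_n\}$.
   Context: $\nu_p$ denotes the $p$-adic valuation on $\mathbb{Z}$, with $\nu_p(0)=+\infty$. -}

module Defs where

open import Data.Nat using (ℕ; zero; suc; _+_; _*_; _^_)
open import Data.Integer using (ℤ)
open import Data.Integer.Divisibility using (_∣_)
open import Data.Product using (_×_)
open import Relation.Nullary using (¬_)

-- The sequence c_i (for i ≥ 1) of the paper, depending on p and k:
--   c_1 = 0,   c_i = p ^ (p ^ k * c_{i-1}) + c_{i-1}  for i ≥ 2.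
-- The value at index 0 is a junk value (0) and is never used.
cseq : ℕ → ℕ → ℕ → ℕ
cseq p k zero = 0
cseq p k (suc zero) = 0
cseq p k (suc (suc i)) = p ^ (p ^ k * cseq p k (suc i)) + cseq p k (suc i)

-- ν_p(x) = m  (for m a natural number): p^m divides x but p^(m+1) does not.
-- For x = 0 we have ν_p(0) = +∞, and indeed HasValuation p m 0 never holds.
HasValuation : ℕ → ℕ → ℤ → Set
HasValuation p m x = (Data.Integer.+ (p ^ m)) ∣ x × ¬ ((Data.Integer.+ (p ^ suc m)) ∣ x)

{-# OPTIONS --safe #-}
-- Write s j = c_{j+1} and K = p ^ k, so that s (j + 1) = p ^ (K s j) + s j with
-- s strictly increasing.  For j < n every later increment p ^ (K s l) is divisible
-- by p ^ (K s j + 1), so s n - s j ≡ p ^ (K s j) modulo p ^ (K s j + 1) and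
-- ν_p(s n - s j) = K s j.  Conversely let p ^ (K c) divide s n - c ≠ 0 with c > 0.
-- If c > s (n - 1), then 0 < |s n - c| < p ^ (K c), which is impossible.  If
-- c < s (n - 1), then p ^ (K c) divides the increment p ^ (K s (n - 1)), hence also
-- s (n - 1) - c, and we descend to n - 1.
module Submission where

open import Defs
open import Data.Nat using (ℕ; _≤_; _<_; _^_; _*_; suc)
open import Data.Nat.Primality using (Prime)
open import Data.Integer using (+_; _-_)
open import Data.Product using (_×_; ∃-syntax)
open import Relation.Binary.PropositionalEquality using (_≡_)
open import Function.Bundles using (_⇔_)

open import Data.Nat.Base
  using (zero; _+_; _∸_; ∣_-_∣; z≤n; s≤s; z<s; NonZero; ≢-nonZero; >-nonZero;
         nonTrivial⇒n>1; _≤′_; ≤′-refl; ≤′-step)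
open import Data.Nat.Properties
open import Data.Nat.Divisibility
  using (_∣_; _∤_; divides; ∣-refl; ∣-trans; _∣0; ∣m∣n⇒∣m+n; ∣m+n∣m⇒∣n; n∣m*n; >⇒∤)
open import Data.Nat.Primality using (prime)
open import Data.Nat.Solver using (module +-*-Solver)
import Data.Integer as ℤ
import Data.Integer.Properties as ℤ
open import Data.Product using (_,_)
open import Data.Sum using (inj₁; inj₂)
open import Data.Empty using (⊥-elim)
open import Function.Base using (_∘_)
open import Function.Bundles using (mk⇔)
open import Function.Properties.Equivalence using () renaming (refl to ⇔-refl; trans to ⇔-trans)
open import Data.Product.Function.NonDependent.Propositional using (_×-⇔_)
open import Relation.Binary.Definitions using (tri<; tri≈; tri>)
open import Relation.Binary.PropositionalEquality using (refl; sym; trans; cong; cong₂; subst; _≢_; module ≡-Reasoning)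

∣m⊖n∣≡∣m-n∣ : ∀ m n → ℤ.∣ m ℤ.⊖ n ∣ ≡ ∣ m - n ∣
∣m⊖n∣≡∣m-n∣ zero    zero    = refl
∣m⊖n∣≡∣m-n∣ zero    (suc n) = refl
∣m⊖n∣≡∣m-n∣ (suc m) zero    = refl
∣m⊖n∣≡∣m-n∣ (suc m) (suc n) = trans (cong ℤ.∣_∣ (ℤ.[1+m]⊖[1+n]≡m⊖n m n)) (∣m⊖n∣≡∣m-n∣ m n)

∣+m-+n∣≡∣m-n∣ : ∀ m n → ℤ.∣ + m - + n ∣ ≡ ∣ m - n ∣
∣+m-+n∣≡∣m-n∣ m n = trans (cong ℤ.∣_∣ (ℤ.[+m]-[+n]≡m⊖n m n)) (∣m⊖n∣≡∣m-n∣ m n)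

∣m+n-o∣≡m+∣n-o∣ : ∀ m {n o} → o ≤ n → ∣ m + n - o ∣ ≡ m + ∣ n - o ∣
∣m+n-o∣≡m+∣n-o∣ m {n} {o} o≤n = begin
  ∣ m + n - o ∣ ≡⟨ m≤n⇒∣n-m∣≡n∸m (≤-trans o≤n (m≤n+m n m)) ⟩
  m + n ∸ o     ≡⟨ +-∸-assoc m o≤n ⟩
  m + (n ∸ o)   ≡⟨ cong (λ x → m + x) (sym (m≤n⇒∣n-m∣≡n∸m o≤n)) ⟩
  m + ∣ n - o ∣ ∎
  where open ≡-Reasoning

∣m-n∣<o : ∀ {m n o} .{{_ : NonZero o}} → n < o → m < o + n → ∣ m - n ∣ < o
∣m-n∣<o {m} {n} {o} n<o m<o+n with ∣m-n∣≡[m∸n]∨[n∸m] m n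
... | inj₁ eq = subst (_< o) (sym eq) (m<n+o⇒m∸n<o m n (subst (m <_) (+-comm o n) m<o+n))
... | inj₂ eq = subst (_< o) (sym eq) (≤-<-trans (m∸n≤m n m) n<o)

m≢n⇒∣m-n∣<o⇒o∤∣m-n∣ : ∀ {m n o} → m ≢ n → ∣ m - n ∣ < o → o ∤ ∣ m - n ∣
m≢n⇒∣m-n∣<o⇒o∤∣m-n∣ m≢n = >⇒∤ {{≢-nonZero (m≢n ∘ ∣m-n∣≡0⇒m≡n)}}

o∤∣m-n∣⇒m≢n : ∀ {m n o} → o ∤ ∣ m - n ∣ → m ≢ n
o∤∣m-n∣⇒m≢n {o = o} o∤ m≡n = o∤ (subst (o ∣_) (sym (m≡n⇒∣m-n∣≡0 m≡n)) (o ∣0))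

n<m^n : ∀ {m} → 1 < m → ∀ n → n < m ^ n
n<m^n 1<m zero    = z<s
n<m^n 1<m (suc n) = ≤-<-trans (n<m^n 1<m n) (^-monoʳ-< _ 1<m (n<1+n n))

^-monoʳ-∣ : ∀ b {m n} → m ≤ n → b ^ m ∣ b ^ n
^-monoʳ-∣ b {m} {n} m≤n = divides (b ^ (n ∸ m)) (begin
  b ^ n             ≡⟨ cong (b ^_) (sym (m∸n+n≡m m≤n)) ⟩
  b ^ (n ∸ m + m)   ≡⟨ ^-distribˡ-+-* b (n ∸ m) m ⟩
  b ^ (n ∸ m) * b ^ m ∎)
  where open ≡-Reasoning

hasValuation-∣-∣ : ∀ p m a b → HasValuation p m (+ a - + b) ⇔ HasValuation p m (+ ∣ a - b ∣)
hasValuation-∣-∣ p m a b = mk⇔ (subst V (∣+m-+n∣≡∣m-n∣ a b)) (subst V (sym (∣+m-+n∣≡∣m-n∣ a b)))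
  where
  V : ℕ → Set
  V x = HasValuation p m (+ x)

hasValuation-t*p^[1+m]+p^m : ∀ {p} .{{_ : NonZero p}} → 1 < p →
  ∀ m t → HasValuation p m (+ (t * p ^ suc m + p ^ m))
hasValuation-t*p^[1+m]+p^m {p} 1<p m t = p^m∣ , p^[1+m]∤
  where
  p^m∣ : p ^ m ∣ t * p ^ suc m + p ^ m
  p^m∣ = ∣m∣n⇒∣m+n (∣-trans (^-monoʳ-∣ p (n≤1+n m)) (n∣m*n t)) ∣-refl
  p^[1+m]∤ : p ^ suc m ∤ t * p ^ suc m + p ^ m
  p^[1+m]∤ p^[1+m]∣ = >⇒∤ {{m^n≢0 p m}} (^-monoʳ-< p 1<p (n<1+n m)) (∣m+n∣m⇒∣n p^[1+m]∣ (n∣m*n t))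

∃[0<j<n]⇔∃[2≤i≤n] : ∀ {n} (P : ℕ → Set) →
  (∃[ j ] (0 < j × j < n × P (suc j))) ⇔ (∃[ i ] (2 ≤ i × i ≤ n × P i))
∃[0<j<n]⇔∃[2≤i≤n] P = mk⇔
  (λ { (j , 0<j , j<n , Pj) → suc j , s≤s 0<j , j<n , Pj })
  (λ { (suc (suc j) , s≤s (s≤s z≤n) , i≤n , Pi) → suc j , z<s , i≤n , Pi })

module Tower {p : ℕ} (1<p : 1 < p) (k : ℕ) where

  private instance
    p≢0 : NonZero p
    p≢0 = >-nonZero (<-trans z<s 1<p)

    p^k≢0 : NonZero (p ^ k)
    p^k≢0 = m^n≢0 p k

  s : ℕ → ℕ
  s j = cseq p k (suc j)

  s-<-suc : ∀ j → s j < s (suc j)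
  s-<-suc j = m<n+m (s j) (m^n>0 p (p ^ k * s j))

  s-strictMono : ∀ {i j} → i < j → s i < s j
  s-strictMono = go ∘ ≤⇒≤′
    where
    go : ∀ {i j} → suc i ≤′ j → s i < s j
    go {i}         ≤′-refl         = s-<-suc i
    go {j = suc j} (≤′-step i<′j) = <-trans (go i<′j) (s-<-suc j)

  s-tail : ∀ {i j} → i < j →
    ∃[ t ] s j ≡ s i + (t * p ^ suc (p ^ k * s i) + p ^ (p ^ k * s i))
  s-tail {i} = go ∘ ≤⇒≤′
    where
    open +-*-Solver
    A = p ^ k * s i
    go : ∀ {j} → suc i ≤′ j → ∃[ t ] s j ≡ s i + (t * p ^ suc A + p ^ A)
    go ≤′-refl = 0 , +-comm (p ^ A) (s i)
    go {suc j} (≤′-step i<′j) with go i<′j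
    ... | t , sj≡ with ^-monoʳ-∣ p (*-monoʳ-< (p ^ k) (s-strictMono (≤′⇒≤ i<′j)))
    ... | divides r p^E≡ = t + r , (begin
      p ^ (p ^ k * s j) + s j                              ≡⟨ cong₂ _+_ p^E≡ sj≡ ⟩
      r * p ^ suc A + (s i + (t * p ^ suc A + p ^ A))      ≡⟨ solve 5 (λ r q x u y →
        r :* q :+ (x :+ (u :* q :+ y)) := x :+ ((u :+ r) :* q :+ y)) refl r (p ^ suc A) (s i) t (p ^ A) ⟩
      s i + ((t + r) * p ^ suc A + p ^ A)                  ∎)
      where open ≡-Reasoning

  hasValuation-∣s-s∣ : ∀ {i j} → i < j → HasValuation p (p ^ k * s i) (+ ∣ s j - s i ∣)
  hasValuation-∣s-s∣ {i} {j} i<j with s-tail i<j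
  ... | t , sj≡ = subst (λ x → HasValuation p (p ^ k * s i) (+ x)) (sym ∣sj-si∣≡)
                    (hasValuation-t*p^[1+m]+p^m 1<p (p ^ k * s i) t)
    where
    ∣sj-si∣≡ : ∣ s j - s i ∣ ≡ t * p ^ suc (p ^ k * s i) + p ^ (p ^ k * s i)
    ∣sj-si∣≡ = trans (cong (∣_- s i ∣) sj≡) (trans (∣-∣-comm (s i + _) (s i)) (∣m-m+n∣≡n (s i) _))

  c<p^[p^k*c] : ∀ c → c < p ^ (p ^ k * c)
  c<p^[p^k*c] c = ≤-<-trans (m≤n*m c (p ^ k)) (n<m^n 1<p (p ^ k * c))

  ∣s-c∣<p^[p^k*c] : ∀ {j c} → s j < p ^ (p ^ k * c) + c → ∣ s j - c ∣ < p ^ (p ^ k * c)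
  ∣s-c∣<p^[p^k*c] {c = c} = ∣m-n∣<o {{m^n≢0 p (p ^ k * c)}} (c<p^[p^k*c] c)

  ∣s-c∣-descent : ∀ {j c} → c < s j →
    p ^ (p ^ k * c) ∣ ∣ s (suc j) - c ∣ → p ^ (p ^ k * c) ∣ ∣ s j - c ∣
  ∣s-c∣-descent {j} {c} c<sj p^∣ = ∣m+n∣m⇒∣n
    (subst (p ^ (p ^ k * c) ∣_) (∣m+n-o∣≡m+∣n-o∣ (p ^ (p ^ k * s j)) (<⇒≤ c<sj)) p^∣)
    (^-monoʳ-∣ p (*-monoʳ-≤ (p ^ k) (<⇒≤ c<sj)))

  p^[p^k*c]∣∣s-c∣⇒c≡s : ∀ n {c} → 0 < c → s n ≢ c → p ^ (p ^ k * c) ∣ ∣ s n - c ∣ →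
    ∃[ j ] (j < n × c ≡ s j)
  p^[p^k*c]∣∣s-c∣⇒c≡s zero {c} 0<c s0≢c p^∣ =
    ⊥-elim (m≢n⇒∣m-n∣<o⇒o∤∣m-n∣ s0≢c (∣s-c∣<p^[p^k*c] {0} (<-≤-trans 0<c (m≤n+m c _))) p^∣)
  p^[p^k*c]∣∣s-c∣⇒c≡s (suc n) {c} 0<c sn+1≢c p^∣ with <-cmp c (s n)
  ... | tri< c<sn _ _ with p^[p^k*c]∣∣s-c∣⇒c≡s n 0<c (>⇒≢ c<sn) (∣s-c∣-descent {n} c<sn p^∣)
  ...   | j , j<n , c≡sj = j , m<n⇒m<1+n j<n , c≡sj
  p^[p^k*c]∣∣s-c∣⇒c≡s (suc n) 0<c _ _ | tri≈ _ c≡sn _ = n , n<1+n n , c≡sn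
  p^[p^k*c]∣∣s-c∣⇒c≡s (suc n) {c} 0<c sn+1≢c p^∣ | tri> _ _ sn<c =
    ⊥-elim (m≢n⇒∣m-n∣<o⇒o∤∣m-n∣ sn+1≢c (∣s-c∣<p^[p^k*c] {suc n} sn+1<p^[p^k*c]+c) p^∣)
    where
    sn+1<p^[p^k*c]+c : s (suc n) < p ^ (p ^ k * c) + c
    sn+1<p^[p^k*c]+c = +-mono-≤-< (^-monoʳ-≤ p (*-monoʳ-≤ (p ^ k) (<⇒≤ sn<c))) sn<c

  hasValuation-s⇔ : ∀ n c →
    (0 < c × HasValuation p (p ^ k * c) (+ ∣ s n - c ∣)) ⇔ (∃[ j ] (0 < j × j < n × c ≡ s j))
  hasValuation-s⇔ n c = mk⇔ to from
    where
    to : 0 < c × HasValuation p (p ^ k * c) (+ ∣ s n - c ∣) → ∃[ j ] (0 < j × j < n × c ≡ s j)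
    to (0<c , p^∣ , p^[1+]∤) with p^[p^k*c]∣∣s-c∣⇒c≡s n 0<c (o∤∣m-n∣⇒m≢n p^[1+]∤) p^∣
    ... | zero  , _   , refl = ⊥-elim (<-irrefl refl 0<c)
    ... | suc j , j<n , c≡sj = suc j , z<s , j<n , c≡sj
    from : ∃[ j ] (0 < j × j < n × c ≡ s j) → 0 < c × HasValuation p (p ^ k * c) (+ ∣ s n - c ∣)
    from (j , 0<j , j<n , refl) = s-strictMono 0<j , hasValuation-∣s-s∣ j<n

lemma2p13 : (p k n : ℕ) → Prime p → 0 < k → 1 ≤ n →
    (c : ℕ) →
    ((0 < c × HasValuation p (p ^ k * c) (+ cseq p k (suc n) - + c))
    ⇔ (∃[ i ] (2 ≤ i × i ≤ n × c ≡ cseq p k i)))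
lemma2p13 p k n (prime {{_}} _) _ _ c =
  ⇔-trans (⇔-refl ×-⇔ hasValuation-∣-∣ p (p ^ k * c) (cseq p k (suc n)) c)
  (⇔-trans (Tower.hasValuation-s⇔ (nonTrivial⇒n>1 p) k n c)
           (∃[0<j<n]⇔∃[2≤i≤n] (λ i → c ≡ cseq p k i)))
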